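{- Let $t[P,Q]$ be a transaction with default activity $P$ and compensation $Q$. Then \[ t\big[[\![P]\!]_{t,\rho}\big] \mid \{\!|Q|\!\}^{\mathrm{npb}(P)}_{t,\rho} \mid \overline{l_t}.k_t \;\rightarrow^{*}\; [\![\mathrm{extr}_D(P)]\!]_{\rho} \mid [\![\langle Q\rangle]\!]_{\rho}. \]
   Context: Source: compensable processes with static compensations (CCS plus transactions $t[P,Q]$, with default activity $P$ and compensation $Q$, and protected blocks $\langle Q\rangle$), with protected blocks and transactions never behind prefixes, under the discarding extraction function: $\mathrm{extr}_D(t[P,Q])=\mathbf{0}$, $\mathrm{extr}_D(\langle P\rangle)=\langle P\rangle$, $\mathrm{extr}_D$ is homomorphic on $\mid$ and $(\nu a)$, and $\mathrm{extr}_D(!P)=\mathrm{extr}_D(\pi.P)=\mathbf{0}$. Target: adaptable processes (CCS without relabeling plus located processes $l[P]$ and update prefixes $l\{(X).Q\}$), with reduction $\rightarrow$ whose key rule is $E[C[l[P]] \mid D[l\{(X).Q\}.R]] \rightarrow E[C[Q\{P/X\}]\mid D[R]]$ for contexts $C ::= [\bullet] \mid C\mid P \mid l[C]$. Abbreviations: $\mathsf{kill}(t)$ denotes $t\{(Y).\mathbf{0}\}$; $z\{P\}$ denotes $z\{(Y).P\}$ with $Y$ not free in $P$; $l\{(X_1,\ldots,X_n).R\}$ denotes $l\{(X_1).l\{(X_2).\cdots l\{(X_n).R\}\}\}$. Paths $\rho$ are finite sequences of names ($\epsilon$ empty). Each name $t$ has associated reserved names $l_t,k_t,p_t,m_t$,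 distinct for distinct $t$. $\mathrm{npb}(P)$ counts protected blocks: $1$ if $P=\langle P_1\rangle$, $\mathrm{npb}(P_1)+\mathrm{npb}(P_2)$ if $P=P_1\mid P_2$, $\mathrm{npb}(P_1)$ if $P=(\nu a)P_1$, $0$ otherwise. The auxiliary process is $\{\!|Q|\!\}^{0}_{t,\rho} = l_t.\overline{m_t}.p_\rho[[\![Q]\!]_\epsilon] \mid m_t.\overline{k_t}.\mathsf{kill}(t)$ and, for $n>0$, $\{\!|Q|\!\}^{n}_{t,\rho} = l_t.p_{t,\rho}\{(X_1,\ldots,X_n).\, z\{p_\rho[X_1]\mid\cdots\mid p_\rho[X_n]\mid \overline{m_t}.p_\rho[[\![Q]\!]_\epsilon]\}\}.(z[\mathbf{0}] \mid m_t.\overline{k_t}.\mathsf{kill}(t))$. The encoding $[\![\cdot]\!]_\rho$ is: $[\![\langle P\rangle]\!]_\rho = p_\rho[[\![P]\!]_\epsilon]$; $[\![t[P,Q]]\!]_\rho = t[[\![P]\!]_{t,\rho}] \mid \{\!|Q|\!\}^{\mathrm{npb}(P)}_{t,\rho} \mid t.\overline{l_t}.k_t.\mathbf{0}$; and homomorphic on $\mathbf{0}$, $\mid$, prefixes $\pi.P$, replication and restriction. -}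

module Defs where

open import Data.Nat as ℕ using (ℕ; zero; suc)
open import Data.List using (List; []; _∷_; _++_; map; foldr; upTo)
open import Data.List.Properties using (≡-dec)
open import Data.List.Membership.Propositional using (_∈_; _∉_)
open import Data.Product using (_×_)
open import Data.Unit using (⊤)
open import Data.Empty using (⊥)
open import Relation.Nullary using (Dec; yes; no; ¬_)
open import Relation.Binary.PropositionalEquality using (_≡_; refl; _≢_)
open import Relation.Binary.Construct.Closure.ReflexiveTransitive using (Star)

data CPre : Set where
  cin  : ℕ → CPre
  cout : ℕ → CPre

data CProc : Set where
  c0   : CProc
  cpre : CPre → CProc → CProc
  crep : CProc → CProc
  cpar : CProc → CProc → CProc
  cnu  : ℕ → CProc → CProc
  ctr  : ℕ → CProc → CProc → CProc
  cpb  : CProc → CProc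

NoTP : CProc → Set
NoTP c0 = ⊤
NoTP (cpre _ P) = NoTP P
NoTP (crep P) = NoTP P
NoTP (cpar P Q) = NoTP P × NoTP Q
NoTP (cnu _ P) = NoTP P
NoTP (ctr _ _ _) = ⊥
NoTP (cpb _) = ⊥

WF : CProc → Set
WF c0 = ⊤
WF (cpre _ P) = NoTP P
WF (crep P) = WF P
WF (cpar P Q) = WF P × WF Q
WF (cnu _ P) = WF P
WF (ctr _ P Q) = WF P × WF Q
WF (cpb P) = WF P

npb : CProc → ℕ
npb (cpb _) = 1
npb (cpar P Q) = npb P ℕ.+ npb Q
npb (cnu _ P) = npb P
npb _ = 0

extrD : CProc → CProc
extrD c0 = c0
extrD (cpre _ _) = c0
extrD (crep _) = c0
extrD (cpar P Q) = cpar (extrD P) (extrD Q)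
extrD (cnu a P) = cnu a (extrD P)
extrD (ctr _ _ _) = c0
extrD (cpb P) = cpb P

-- Target names: source names, the reserved names l_t, k_t, m_t, p_ρ
-- (p_t is p_(t∷ε), p_(t,ρ) is p_(t∷ρ)), and the name z.
data TName : Set where
  nm : ℕ → TName
  lN : ℕ → TName
  kN : ℕ → TName
  mN : ℕ → TName
  pN : List ℕ → TName
  zN : TName

_≟N_ : (x y : TName) → Dec (x ≡ y)
nm x ≟N nm y with x ℕ.≟ y
... | yes refl = yes refl
... | no ¬p = no λ { refl → ¬p refl }
nm x ≟N lN y = no λ ()
nm x ≟N kN y = no λ ()
nm x ≟N mN y = no λ ()
nm x ≟N pN y = no λ ()
nm x ≟N zN = no λ ()
lN x ≟N nm y = no λ ()
lN x ≟N lN y with x ℕ.≟ y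
... | yes refl = yes refl
... | no ¬p = no λ { refl → ¬p refl }
lN x ≟N kN y = no λ ()
lN x ≟N mN y = no λ ()
lN x ≟N pN y = no λ ()
lN x ≟N zN = no λ ()
kN x ≟N nm y = no λ ()
kN x ≟N lN y = no λ ()
kN x ≟N kN y with x ℕ.≟ y
... | yes refl = yes refl
... | no ¬p = no λ { refl → ¬p refl }
kN x ≟N mN y = no λ ()
kN x ≟N pN y = no λ ()
kN x ≟N zN = no λ ()
mN x ≟N nm y = no λ ()
mN x ≟N lN y = no λ ()
mN x ≟N kN y = no λ ()
mN x ≟N mN y with x ℕ.≟ y
... | yes refl = yes refl
... | no ¬p = no λ { refl → ¬p refl }
mN x ≟N pN y = no λ ()
mN x ≟N zN = no λ ()
pN x ≟N nm y = no λ ()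
pN x ≟N lN y = no λ ()
pN x ≟N kN y = no λ ()
pN x ≟N mN y = no λ ()
pN x ≟N pN y with ≡-dec ℕ._≟_ x y
... | yes refl = yes refl
... | no ¬p = no λ { refl → ¬p refl }
pN x ≟N zN = no λ ()
zN ≟N nm y = no λ ()
zN ≟N lN y = no λ ()
zN ≟N kN y = no λ ()
zN ≟N mN y = no λ ()
zN ≟N pN y = no λ ()
zN ≟N zN = yes refl

PVar : Set
PVar = ℕ

data APre : Set where
  ain  : TName → APre
  aout : TName → APre

chan : APre → TName
chan (ain a) = a
chan (aout a) = a

data AProc : Set where
  a0   : AProc
  apre : APre → AProc → AProc
  arep : AProc → AProc
  apar : AProc → AProc → AProc
  anu  : TName → AProc → AProc
  aloc : TName → AProc → AProc
  aupd : TName → PVar → AProc → AProc → AProc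
  avar : PVar → AProc

removeN : TName → List TName → List TName
removeN a [] = []
removeN a (b ∷ bs) with a ≟N b
... | yes _ = removeN a bs
... | no _ = b ∷ removeN a bs

removeV : PVar → List PVar → List PVar
removeV x [] = []
removeV x (y ∷ ys) with x ℕ.≟ y
... | yes _ = removeV x ys
... | no _ = y ∷ removeV x ys

fn : AProc → List TName
fn a0 = []
fn (apre π P) = chan π ∷ fn P
fn (arep P) = fn P
fn (apar P Q) = fn P ++ fn Q
fn (anu a P) = removeN a (fn P)
fn (aloc l P) = l ∷ fn P
fn (aupd l _ Q R) = l ∷ (fn Q ++ fn R)
fn (avar _) = []

names : AProc → List TName
names a0 = []
names (apre π P) = chan π ∷ names P
names (arep P) = names P
names (apar P Q) = names P ++ names Q
names (anu a P) = a ∷ names P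
names (aloc l P) = l ∷ names P
names (aupd l _ Q R) = l ∷ (names Q ++ names R)
names (avar _) = []

bn : AProc → List TName
bn a0 = []
bn (apre π P) = bn P
bn (arep P) = bn P
bn (apar P Q) = bn P ++ bn Q
bn (anu a P) = a ∷ bn P
bn (aloc l P) = bn P
bn (aupd l _ Q R) = bn Q ++ bn R
bn (avar _) = []

fv : AProc → List PVar
fv a0 = []
fv (apre π P) = fv P
fv (arep P) = fv P
fv (apar P Q) = fv P ++ fv Q
fv (anu a P) = fv P
fv (aloc l P) = fv P
fv (aupd l X Q R) = removeV X (fv Q) ++ fv R
fv (avar X) = X ∷ []

bv : AProc → List PVar
bv a0 = []
bv (apre π P) = bv P
bv (arep P) = bv P
bv (apar P Q) = bv P ++ bv Q
bv (anu a P) = bv P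
bv (aloc l P) = bv P
bv (aupd l X Q R) = X ∷ (bv Q ++ bv R)
bv (avar X) = []

-- renaming of the free occurrences of a name a by b
-- (only used when b does not occur in the process, so it is capture-free)
rnN : TName → TName → TName → TName
rnN a b c with a ≟N c
... | yes _ = b
... | no _ = c

rnP : TName → TName → APre → APre
rnP a b (ain c) = ain (rnN a b c)
rnP a b (aout c) = aout (rnN a b c)

ren : TName → TName → AProc → AProc
ren a b a0 = a0
ren a b (apre π P) = apre (rnP a b π) (ren a b P)
ren a b (arep P) = arep (ren a b P)
ren a b (apar P Q) = apar (ren a b P) (ren a b Q)
ren a b (anu c P) with a ≟N c
... | yes _ = anu c P
... | no _ = anu c (ren a b P)
ren a b (aloc l P) = aloc (rnN a b l) (ren a b P)
ren a b (aupd l X Q R) = aupd (rnN a b l) X (ren a b Q) (ren a b R)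
ren a b (avar X) = avar X

-- process substitution  Q{P/X}  (written  psub P X Q)
psub : AProc → PVar → AProc → AProc
psub P X a0 = a0
psub P X (apre π Q) = apre π (psub P X Q)
psub P X (arep Q) = arep (psub P X Q)
psub P X (apar Q R) = apar (psub P X Q) (psub P X R)
psub P X (anu a Q) = anu a (psub P X Q)
psub P X (aloc l Q) = aloc l (psub P X Q)
psub P X (aupd l Y Q R) with X ℕ.≟ Y
... | yes _ = aupd l Y Q (psub P X R)
... | no _ = aupd l Y (psub P X Q) (psub P X R)
psub P X (avar Y) with X ℕ.≟ Y
... | yes _ = P
... | no _ = avar Y

-- the substitution Q{P/X} performed naively is capture-avoiding
NoCapture : AProc → AProc → Set
NoCapture P Q = (∀ a → a ∈ fn P → a ∉ bn Q) × (∀ x → x ∈ fv P → x ∉ bv Q)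

infix 4 _≈_
data _≈_ : AProc → AProc → Set where
  ≈-refl  : ∀ {P} → P ≈ P
  ≈-sym   : ∀ {P Q} → P ≈ Q → Q ≈ P
  ≈-trans : ∀ {P Q R} → P ≈ Q → Q ≈ R → P ≈ R
  c-pre   : ∀ {π P P'} → P ≈ P' → apre π P ≈ apre π P'
  c-rep   : ∀ {P P'} → P ≈ P' → arep P ≈ arep P'
  c-par   : ∀ {P P' Q Q'} → P ≈ P' → Q ≈ Q' → apar P Q ≈ apar P' Q'
  c-nu    : ∀ {a P P'} → P ≈ P' → anu a P ≈ anu a P'
  c-loc   : ∀ {l P P'} → P ≈ P' → aloc l P ≈ aloc l P'
  c-upd   : ∀ {l X Q Q' R R'} → Q ≈ Q' → R ≈ R' → aupd l X Q R ≈ aupd l X Q' R'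
  par-comm  : ∀ {P Q} → apar P Q ≈ apar Q P
  par-assoc : ∀ {P Q R} → apar (apar P Q) R ≈ apar P (apar Q R)
  par-unit  : ∀ {P} → apar P a0 ≈ P
  rep-unf   : ∀ {P} → arep P ≈ apar P (arep P)
  nu-comm   : ∀ {a b P} → anu a (anu b P) ≈ anu b (anu a P)
  nu-zero   : ∀ {a} → anu a a0 ≈ a0
  nu-par    : ∀ {a P Q} → a ∉ fn Q → apar (anu a P) Q ≈ anu a (apar P Q)
  nu-loc    : ∀ {a l P} → a ≢ l → aloc l (anu a P) ≈ anu a (aloc l P)
  alpha     : ∀ {a b P} → b ∉ names P → anu a P ≈ anu b (ren a b P)

data Ctx : Set where
  hole : Ctx
  cxpar : Ctx → AProc → Ctx
  cxloc : TName → Ctx → Ctx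

plug : Ctx → AProc → AProc
plug hole P = P
plug (cxpar C Q) P = apar (plug C P) Q
plug (cxloc l C) P = aloc l (plug C P)

data ECtx : Set where
  ehole : ECtx
  expar : ECtx → AProc → ECtx
  exloc : TName → ECtx → ECtx
  exnu  : TName → ECtx → ECtx

eplug : ECtx → AProc → AProc
eplug ehole P = P
eplug (expar E Q) P = apar (eplug E P) Q
eplug (exloc l E) P = aloc l (eplug E P)
eplug (exnu a E) P = anu a (eplug E P)

infix 4 _⟶_
data _⟶_ : AProc → AProc → Set where
  r-comm : ∀ E C D a P Q →
    eplug E (apar (plug C (apre (ain a) P)) (plug D (apre (aout a) Q)))
      ⟶ eplug E (apar (plug C P) (plug D Q))
  r-upd : ∀ E C D l P X Q R → NoCapture P Q →
    eplug E (apar (plug C (aloc l P)) (plug D (aupd l X Q R)))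
      ⟶ eplug E (apar (plug C (psub P X Q)) (plug D R))
  r-str : ∀ {P P' Q' Q} → P ≈ P' → P' ⟶ Q' → Q' ≈ Q → P ⟶ Q

infix 4 _⟶*_
_⟶*_ : AProc → AProc → Set
_⟶*_ = Star _⟶_

Path : Set
Path = List ℕ

kill : TName → AProc
kill t = aupd t 0 a0 a0

-- z{P} = z{(Y).P}, Y = variable 0 (not free in the P's used below)
zupd : AProc → AProc
zupd P = aupd zN 0 P a0

-- l{(X1,...,Xn).R}  (nested updates, inner continuations 0)
nestBody : TName → List PVar → AProc → AProc
nestBody l [] R = R
nestBody l (x ∷ xs) R = aupd l x (nestBody l xs R) a0

-- variables X_1 ... X_n are 1 ... n
vars : ℕ → List PVar
vars n = map suc (upTo n)

encPre : CPre → APre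
encPre (cin a) = ain (nm a)
encPre (cout a) = aout (nm a)

-- the auxiliary process {| Q |}^n_{t,ρ}, given  Q' = [[Q]]_ε
aux : ℕ → ℕ → Path → AProc → AProc
aux zero t ρ Q' =
  apar (apre (ain (lN t)) (apre (aout (mN t)) (aloc (pN ρ) Q')))
       (apre (ain (mN t)) (apre (aout (kN t)) (kill (nm t))))
aux (suc n) t ρ Q' =
  apre (ain (lN t))
    (aupd (pN (t ∷ ρ)) 1
       (nestBody (pN (t ∷ ρ)) (map suc (vars n))
          (zupd (foldr (λ x acc → apar (aloc (pN ρ) (avar x)) acc)
                       (apre (aout (mN t)) (aloc (pN ρ) Q'))
                       (vars (suc n)))))
       (apar (aloc zN a0)
             (apre (ain (mN t)) (apre (aout (kN t)) (kill (nm t))))))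

enc : Path → CProc → AProc
enc ρ c0 = a0
enc ρ (cpre π P) = apre (encPre π) (enc ρ P)
enc ρ (crep P) = arep (enc ρ P)
enc ρ (cpar P Q) = apar (enc ρ P) (enc ρ Q)
enc ρ (cnu a P) = anu (nm a) (enc ρ P)
enc ρ (ctr t P Q) =
  apar (apar (aloc (nm t) (enc (t ∷ ρ) P)) (aux (npb P) t ρ (enc [] Q)))
       (apre (ain (nm t)) (apre (aout (lN t)) (apre (ain (kN t)) a0)))
enc ρ (cpb P) = aloc (pN ρ) (enc [] P)

module Submission where

-- [[P]]_{t,ρ} is, up to α-conversion and structural congruence,
-- (ν b̃)(p_{t,ρ}[D₁] | … | p_{t,ρ}[Dₙ] | R), where n = npb P and the Dᵢ are the encoded
-- protected blocks of P, while [[extr_D P]]_ρ ≡ (ν b̃)(p_ρ[D₁] | … | p_ρ[Dₙ]).  Under (ν b̃)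
-- the trigger l̄_t meets l_t; the n nested updates on p_{t,ρ} move D₁, …, Dₙ into the body
-- of the update on z, which then fires on z[0] and releases p_ρ[D₁] | … | p_ρ[Dₙ] together
-- with m̄_t.p_ρ[[[Q]]] (for n = 0 the latter is offered right after l_t); finally m_t and
-- k_t synchronise and kill(t) discards what is left of the transaction.  An update fires
-- only if it captures no free name, so the bound names of the Dᵢ and of [[Q]] are first
-- renamed to source names above every name occurring in the process.

open import Defs
open import Algebra.Bundles using (CommutativeMonoid)
open import Data.Empty using (⊥-elim)
open import Data.List using (List; []; _∷_; _++_; map; foldr; upTo; length)
open import Data.List.Properties
  using (++-assoc; ++-identityʳ; length-map; length-++; length-upTo; map-++; map-applyUpTo)
open import Data.List.Membership.Propositional using (_∈_; _∉_)
open import Data.List.Membership.Propositional.Properties using (∈-++⁻; ∈-++⁺ˡ; ∈-++⁺ʳ; ∈-map⁻)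
open import Data.List.Relation.Binary.Disjoint.Propositional using (Disjoint; contractₗ)
open import Data.List.Relation.Binary.Subset.Propositional using (_⊆_)
import Data.List.Relation.Binary.Subset.Propositional.Properties as ⊆
open import Data.List.Relation.Unary.All as All using (All; []; _∷_)
open import Data.List.Relation.Unary.All.Properties
  using (++⁺; ++⁻ˡ; ++⁻ʳ; anti-mono; All¬⇒¬Any) renaming (map⁺ to All-map⁺)
open import Data.List.Relation.Unary.AllPairs using (_∷_)
open import Data.List.Relation.Unary.Any using (here; there)
open import Data.List.Relation.Unary.Unique.Propositional using (Unique)
import Data.List.Relation.Unary.Unique.Propositional.Properties as Unique
open import Data.Nat as ℕ using (ℕ; zero; suc; _≤_; _⊔_; _+_)
import Data.Nat.Properties as ℕ
open import Data.Product using (_×_; _,_; proj₁; proj₂; map₁; map₂; ∃-syntax; uncurry)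
open import Data.Sum as Sum using (_⊎_; inj₁; inj₂)
open import Function using (_∘_; id)
open import Relation.Binary.Bundles using (Setoid)
open import Relation.Binary.Construct.Closure.ReflexiveTransitive using (ε; _◅_)
open import Relation.Binary.Construct.Closure.Transitive using (TransClosure; [_]; _∷_)
  renaming (_++_ to _◅◅⁺_)
open import Relation.Binary.PropositionalEquality
  using (_≡_; _≢_; refl; sym; trans; cong; cong₂; subst; subst₂; module ≡-Reasoning)
import Relation.Binary.Reasoning.Setoid
open import Relation.Nullary using (yes; no; ¬_)

∈-removeN⁻ : ∀ {a x} bs → x ∈ removeN a bs → x ≢ a × x ∈ bs
∈-removeN⁻ [] ()
∈-removeN⁻ {a} (b ∷ bs) m with a ≟N b | m
... | yes refl | m'        = map₂ there (∈-removeN⁻ bs m')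
... | no a≢b   | here refl = a≢b ∘ sym , here refl
... | no _     | there m'  = map₂ there (∈-removeN⁻ bs m')

∈-removeN⁺ : ∀ {a x} bs → x ≢ a → x ∈ bs → x ∈ removeN a bs
∈-removeN⁺ [] _ ()
∈-removeN⁺ {a} (b ∷ bs) x≢a m with a ≟N b | m
... | yes refl | here refl = ⊥-elim (x≢a refl)
... | yes refl | there m'  = ∈-removeN⁺ bs x≢a m'
... | no _     | here e    = here e
... | no _     | there m'  = there (∈-removeN⁺ bs x≢a m')

∈-removeV⁻ : ∀ {a x} xs → x ∈ removeV a xs → x ≢ a × x ∈ xs
∈-removeV⁻ [] ()
∈-removeV⁻ {a} (y ∷ ys) m with a ℕ.≟ y | m
... | yes refl | m'        = map₂ there (∈-removeV⁻ ys m')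
... | no a≢y   | here refl = a≢y ∘ sym , here refl
... | no _     | there m'  = map₂ there (∈-removeV⁻ ys m')

∈-removeV⁺ : ∀ {a x} xs → x ≢ a → x ∈ xs → x ∈ removeV a xs
∈-removeV⁺ [] _ ()
∈-removeV⁺ {a} (y ∷ ys) x≢a m with a ℕ.≟ y | m
... | yes refl | here refl = ⊥-elim (x≢a refl)
... | yes refl | there m'  = ∈-removeV⁺ ys x≢a m'
... | no _     | here e    = here e
... | no _     | there m'  = there (∈-removeV⁺ ys x≢a m')

0∉map-suc : ∀ xs → 0 ∉ map suc xs
0∉map-suc xs m with ∈-map⁻ suc m
... | _ , _ , ()

vars-suc : ∀ n → vars (suc n) ≡ 1 ∷ map suc (vars n)
vars-suc n = cong (λ xs → 1 ∷ map suc xs) (sym (map-applyUpTo id suc n))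

vars-unique : ∀ n → Unique (vars n)
vars-unique n = Unique.map⁺ ℕ.suc-injective (Unique.upTo⁺ n)

length-vars : ∀ n → length (vars n) ≡ n
length-vars n = trans (length-map suc (upTo n)) (length-upTo n)

∈-vars-suc⁻ : ∀ n {x} → x ∈ vars (suc n) → x ≡ 1 ⊎ x ∈ map suc (vars n)
∈-vars-suc⁻ n {x} m with subst (x ∈_) (vars-suc n) m
... | here x≡1 = inj₁ x≡1
... | there m' = inj₂ m'

unique-later-vars : ∀ n → 1 ∉ map suc (vars n) × Unique (map suc (vars n))
unique-later-vars n with subst Unique (vars-suc n) (vars-unique (suc n))
... | 1≢xs ∷ u = All¬⇒¬Any 1≢xs , u

fn⊆names : ∀ A → fn A ⊆ names A
fn⊆names a0 ()
fn⊆names (apre π A) = ⊆.∷⁺ʳ (chan π) (fn⊆names A)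
fn⊆names (arep A) = fn⊆names A
fn⊆names (apar A B) = ⊆.++⁺ (fn⊆names A) (fn⊆names B)
fn⊆names (anu a A) m = there (fn⊆names A (proj₂ (∈-removeN⁻ (fn A) m)))
fn⊆names (aloc l A) = ⊆.∷⁺ʳ l (fn⊆names A)
fn⊆names (aupd l X A B) = ⊆.∷⁺ʳ l (⊆.++⁺ (fn⊆names A) (fn⊆names B))
fn⊆names (avar X) ()

rnN-≢ : ∀ {a c} b → a ≢ c → rnN a b c ≡ c
rnN-≢ {a} {c} b a≢c with a ≟N c
... | yes a≡c = ⊥-elim (a≢c a≡c)
... | no _    = refl

∈-rnN : ∀ a b c {x} → x ≡ rnN a b c → x ≡ b ⊎ (x ≡ c × x ≢ a)
∈-rnN a b c x≡ with a ≟N c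
... | yes _   = inj₁ x≡
... | no a≢c  = inj₂ (x≡ , λ x≡a → a≢c (trans (sym x≡a) x≡))

chan-rnP : ∀ a b π → chan (rnP a b π) ≡ rnN a b (chan π)
chan-rnP a b (ain c)  = refl
chan-rnP a b (aout c) = refl

∈-fn-ren⁻ : ∀ a b A {x} → x ∈ fn (ren a b A) → x ≡ b ⊎ (x ∈ fn A × x ≢ a)
∈-fn-ren⁻ a b a0 ()
∈-fn-ren⁻ a b (apre π A) (here e) =
  Sum.map₂ (map₁ here) (∈-rnN a b (chan π) (trans e (chan-rnP a b π)))
∈-fn-ren⁻ a b (apre π A) (there m) = Sum.map₂ (λ (m' , x≢a) → there m' , x≢a) (∈-fn-ren⁻ a b A m)
∈-fn-ren⁻ a b (arep A) m = ∈-fn-ren⁻ a b A m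
∈-fn-ren⁻ a b (apar A B) m with ∈-++⁻ (fn (ren a b A)) m
... | inj₁ m' = Sum.map₂ (λ (m'' , x≢a) → ∈-++⁺ˡ m'' , x≢a) (∈-fn-ren⁻ a b A m')
... | inj₂ m' = Sum.map₂ (λ (m'' , x≢a) → ∈-++⁺ʳ (fn A) m'' , x≢a) (∈-fn-ren⁻ a b B m')
∈-fn-ren⁻ a b (anu c A) m with a ≟N c
... | yes refl = inj₂ (m , proj₁ (∈-removeN⁻ (fn A) m))
... | no _ with ∈-removeN⁻ (fn (ren a b A)) m
...   | x≢c , m' = Sum.map₂ (λ (m'' , x≢a) → ∈-removeN⁺ (fn A) x≢c m'' , x≢a) (∈-fn-ren⁻ a b A m')
∈-fn-ren⁻ a b (aloc l A) (here e) = Sum.map₂ (λ (x≡l , x≢a) → here x≡l , x≢a) (∈-rnN a b l e)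
∈-fn-ren⁻ a b (aloc l A) (there m) = Sum.map₂ (λ (m' , x≢a) → there m' , x≢a) (∈-fn-ren⁻ a b A m)
∈-fn-ren⁻ a b (aupd l X A B) (here e) = Sum.map₂ (λ (x≡l , x≢a) → here x≡l , x≢a) (∈-rnN a b l e)
∈-fn-ren⁻ a b (aupd l X A B) (there m) with ∈-++⁻ (fn (ren a b A)) m
... | inj₁ m' = Sum.map₂ (λ (m'' , x≢a) → there (∈-++⁺ˡ m'') , x≢a) (∈-fn-ren⁻ a b A m')
... | inj₂ m' = Sum.map₂ (λ (m'' , x≢a) → there (∈-++⁺ʳ (fn A) m'') , x≢a) (∈-fn-ren⁻ a b B m')
∈-fn-ren⁻ a b (avar X) ()

∈-names-ren⁻ : ∀ a b A {x} → x ∈ names (ren a b A) → x ≡ b ⊎ x ∈ names A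
∈-names-ren⁻ a b a0 ()
∈-names-ren⁻ a b (apre π A) (here e) =
  Sum.map₂ (here ∘ proj₁) (∈-rnN a b (chan π) (trans e (chan-rnP a b π)))
∈-names-ren⁻ a b (apre π A) (there m) = Sum.map₂ there (∈-names-ren⁻ a b A m)
∈-names-ren⁻ a b (arep A) m = ∈-names-ren⁻ a b A m
∈-names-ren⁻ a b (apar A B) m with ∈-++⁻ (names (ren a b A)) m
... | inj₁ m' = Sum.map₂ ∈-++⁺ˡ (∈-names-ren⁻ a b A m')
... | inj₂ m' = Sum.map₂ (∈-++⁺ʳ (names A)) (∈-names-ren⁻ a b B m')
∈-names-ren⁻ a b (anu c A) m with a ≟N c | m
... | yes _ | m'       = inj₂ m'
... | no _  | here e   = inj₂ (here e)
... | no _  | there m' = Sum.map₂ there (∈-names-ren⁻ a b A m')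
∈-names-ren⁻ a b (aloc l A) (here e) = Sum.map₂ (here ∘ proj₁) (∈-rnN a b l e)
∈-names-ren⁻ a b (aloc l A) (there m) = Sum.map₂ there (∈-names-ren⁻ a b A m)
∈-names-ren⁻ a b (aupd l X A B) (here e) = Sum.map₂ (here ∘ proj₁) (∈-rnN a b l e)
∈-names-ren⁻ a b (aupd l X A B) (there m) with ∈-++⁻ (names (ren a b A)) m
... | inj₁ m' = Sum.map₂ (there ∘ ∈-++⁺ˡ) (∈-names-ren⁻ a b A m')
... | inj₂ m' = Sum.map₂ (there ∘ ∈-++⁺ʳ (names A)) (∈-names-ren⁻ a b B m')
∈-names-ren⁻ a b (avar X) ()

bn-ren : ∀ a b A → bn (ren a b A) ≡ bn A
bn-ren a b a0 = refl
bn-ren a b (apre π A) = bn-ren a b A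
bn-ren a b (arep A) = bn-ren a b A
bn-ren a b (apar A B) = cong₂ _++_ (bn-ren a b A) (bn-ren a b B)
bn-ren a b (anu c A) with a ≟N c
... | yes _ = refl
... | no _  = cong (c ∷_) (bn-ren a b A)
bn-ren a b (aloc l A) = bn-ren a b A
bn-ren a b (aupd l X A B) = cong₂ _++_ (bn-ren a b A) (bn-ren a b B)
bn-ren a b (avar X) = refl

fv-ren : ∀ a b A → fv (ren a b A) ≡ fv A
fv-ren a b a0 = refl
fv-ren a b (apre π A) = fv-ren a b A
fv-ren a b (arep A) = fv-ren a b A
fv-ren a b (apar A B) = cong₂ _++_ (fv-ren a b A) (fv-ren a b B)
fv-ren a b (anu c A) with a ≟N c
... | yes _ = refl
... | no _  = fv-ren a b A
fv-ren a b (aloc l A) = fv-ren a b A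
fv-ren a b (aupd l X A B) = cong₂ _++_ (cong (removeV X) (fv-ren a b A)) (fv-ren a b B)
fv-ren a b (avar X) = refl

≈-reflexive : ∀ {A B} → A ≡ B → A ≈ B
≈-reflexive refl = ≈-refl

≈-setoid : Setoid _ _
≈-setoid = record
  { Carrier = AProc ; _≈_ = _≈_
  ; isEquivalence = record { refl = ≈-refl ; sym = ≈-sym ; trans = ≈-trans } }

module ≈-Reasoning = Relation.Binary.Reasoning.Setoid ≈-setoid

par-unitˡ : ∀ {A} → apar a0 A ≈ A
par-unitˡ = ≈-trans par-comm par-unit

par-commutativeMonoid : CommutativeMonoid _ _
par-commutativeMonoid = record
  { Carrier = AProc ; _≈_ = _≈_ ; _∙_ = apar ; ε = a0
  ; isCommutativeMonoid = record
    { isMonoid = record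
      { isSemigroup = record
        { isMagma = record
          { isEquivalence = Setoid.isEquivalence ≈-setoid ; ∙-cong = c-par }
        ; assoc = λ _ _ _ → par-assoc }
      ; identity = (λ _ → par-unitˡ) , (λ _ → par-unit) }
    ; comm = λ _ _ → par-comm } }

open import Algebra.Solver.CommutativeMonoid par-commutativeMonoid
  using (solve; _⊜_; _⊕_) renaming (id to ∅)

nestBody-cong : ∀ l xs {Z Z'} → Z ≈ Z' → nestBody l xs Z ≈ nestBody l xs Z'
nestBody-cong l []       p = p
nestBody-cong l (x ∷ xs) p = c-upd (nestBody-cong l xs p) ≈-refl

restrict : List TName → AProc → AProc
restrict []       A = A
restrict (b ∷ bs) A = anu b (restrict bs A)

restrict-cong : ∀ bs {A B} → A ≈ B → restrict bs A ≈ restrict bs B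
restrict-cong []       p = p
restrict-cong (b ∷ bs) p = c-nu (restrict-cong bs p)

restrict-++ : ∀ bs cs A → restrict (bs ++ cs) A ≡ restrict bs (restrict cs A)
restrict-++ []       cs A = refl
restrict-++ (b ∷ bs) cs A = cong (anu b) (restrict-++ bs cs A)

restrict-parʳ : ∀ bs {A B} → Disjoint bs (fn B) → apar (restrict bs A) B ≈ restrict bs (apar A B)
restrict-parʳ []       _ = ≈-refl
restrict-parʳ (b ∷ bs) d =
  ≈-trans (nu-par (λ m → d (here refl , m))) (c-nu (restrict-parʳ bs (contractₗ d)))

restrict-parˡ : ∀ bs {A B} → Disjoint bs (fn A) → apar A (restrict bs B) ≈ restrict bs (apar A B)
restrict-parˡ bs d = ≈-trans par-comm (≈-trans (restrict-parʳ bs d) (restrict-cong bs par-comm))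

restrict-par : ∀ bs cs {A B} → Disjoint bs (fn (restrict cs B)) → Disjoint cs (fn A) →
  apar (restrict bs A) (restrict cs B) ≈ restrict (bs ++ cs) (apar A B)
restrict-par bs cs {A} {B} d₁ d₂ =
  ≈-trans (restrict-parʳ bs d₁)
    (≈-trans (restrict-cong bs (restrict-parˡ cs d₂)) (≈-reflexive (sym (restrict-++ bs cs (apar A B)))))

restrict-loc : ∀ bs {l A} → All (_≢ l) bs → aloc l (restrict bs A) ≈ restrict bs (aloc l A)
restrict-loc []       _           = ≈-refl
restrict-loc (b ∷ bs) (b≢l ∷ h) = ≈-trans (nu-loc b≢l) (c-nu (restrict-loc bs h))

extrude-restrict : ∀ bs {l W A G} → All (_≢ l) bs → Disjoint bs (fn A) → Disjoint bs (fn G) →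
  apar (apar (aloc l (restrict bs W)) A) G ≈ restrict bs (apar (apar (aloc l W) A) G)
extrude-restrict bs l∉bs dA dG =
  ≈-trans (c-par (≈-trans (c-par (restrict-loc bs l∉bs) ≈-refl) (restrict-parʳ bs dA)) ≈-refl)
          (restrict-parʳ bs dG)

∈-fn-restrict⁻ : ∀ bs A {x} → x ∈ fn (restrict bs A) → x ∈ fn A × x ∉ bs
∈-fn-restrict⁻ []       A m = m , λ ()
∈-fn-restrict⁻ (b ∷ bs) A m with ∈-removeN⁻ (fn (restrict bs A)) m
... | x≢b , m' with ∈-fn-restrict⁻ bs A m'
...   | m'' , x∉bs = m'' , λ { (here x≡b) → x≢b x≡b ; (there x∈bs) → x∉bs x∈bs }

∈-names-restrict⁻ : ∀ bs A {x} → x ∈ names (restrict bs A) → x ∈ bs ⊎ x ∈ names A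
∈-names-restrict⁻ []       A m         = inj₂ m
∈-names-restrict⁻ (b ∷ bs) A (here e)  = inj₁ (here e)
∈-names-restrict⁻ (b ∷ bs) A (there m) = Sum.map₁ there (∈-names-restrict⁻ bs A m)

ren-restrict : ∀ {a} b bs A → All (a ≢_) bs → ren a b (restrict bs A) ≡ restrict bs (ren a b A)
ren-restrict b [] A _ = refl
ren-restrict {a} b (c ∷ bs) A (a≢c ∷ h) with a ≟N c
... | yes a≡c = ⊥-elim (a≢c a≡c)
... | no _    = cong (anu c) (ren-restrict b bs A h)

alpha-restrict : ∀ {a b} bs W → b ∉ bs → b ∉ names W → All (a ≢_) bs →
  anu a (restrict bs W) ≈ anu b (restrict bs (ren a b W))
alpha-restrict {b = b} bs W b∉bs b∉W h =
  ≈-trans (alpha (Sum.[ b∉bs , b∉W ] ∘ ∈-names-restrict⁻ bs W))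
          (≈-reflexive (cong (anu b) (ren-restrict b bs W h)))

blocks : TName → List AProc → AProc
blocks l []       = a0
blocks l (C ∷ Cs) = apar (aloc l C) (blocks l Cs)

blocks-++ : ∀ l Cs Ds → blocks l (Cs ++ Ds) ≈ apar (blocks l Cs) (blocks l Ds)
blocks-++ l []       Ds = ≈-sym par-unitˡ
blocks-++ l (C ∷ Cs) Ds = ≈-trans (c-par ≈-refl (blocks-++ l Cs Ds)) (≈-sym par-assoc)

blocks-map : ∀ l {f} Cs → All (λ C → C ≈ f C) Cs → blocks l Cs ≈ blocks l (map f Cs)
blocks-map l []       []       = ≈-refl
blocks-map l (C ∷ Cs) (p ∷ ps) = c-par (c-loc p) (blocks-map l Cs ps)

ren-blocks : ∀ {a} b {l} Cs → a ≢ l → ren a b (blocks l Cs) ≡ blocks l (map (ren a b) Cs)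
ren-blocks b []               _   = refl
ren-blocks {a} b {l} (C ∷ Cs) a≢l =
  cong₂ (λ l' → apar (aloc l' (ren a b C))) (rnN-≢ b a≢l) (ren-blocks b Cs a≢l)

names-blocks : ∀ {P : TName → Set} l Cs → P l → All (All P ∘ names) Cs → All P (names (blocks l Cs))
names-blocks l []       _  []       = []
names-blocks l (C ∷ Cs) pl (h ∷ hs) = ++⁺ (pl ∷ h) (names-blocks l Cs pl hs)

bn-blocks : ∀ {P : TName → Set} l Cs → All (All P ∘ bn) Cs → All P (bn (blocks l Cs))
bn-blocks l []       []       = []
bn-blocks l (C ∷ Cs) (h ∷ hs) = ++⁺ h (bn-blocks l Cs hs)

slots-≈ : ∀ l xs {e e'} → e ≈ e' →
  foldr (λ x acc → apar (aloc l (avar x)) acc) e xs ≈ apar (blocks l (map avar xs)) e'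
slots-≈ l []       p = ≈-trans p (≈-sym par-unitˡ)
slots-≈ l (x ∷ xs) p = ≈-trans (c-par ≈-refl (slots-≈ l xs p)) (≈-sym par-assoc)

_⊚_ : ECtx → ECtx → ECtx
ehole     ⊚ E' = E'
expar E Q ⊚ E' = expar (E ⊚ E') Q
exloc l E ⊚ E' = exloc l (E ⊚ E')
exnu a E  ⊚ E' = exnu a (E ⊚ E')

eplug-⊚ : ∀ E E' A → eplug (E ⊚ E') A ≡ eplug E (eplug E' A)
eplug-⊚ ehole       E' A = refl
eplug-⊚ (expar E Q) E' A = cong (λ B → apar B Q) (eplug-⊚ E E' A)
eplug-⊚ (exloc l E) E' A = cong (aloc l) (eplug-⊚ E E' A)
eplug-⊚ (exnu a E)  E' A = cong (anu a) (eplug-⊚ E E' A)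

eplug-cong : ∀ E {A B} → A ≈ B → eplug E A ≈ eplug E B
eplug-cong ehole       p = p
eplug-cong (expar E Q) p = c-par (eplug-cong E p) ≈-refl
eplug-cong (exloc l E) p = c-loc (eplug-cong E p)
eplug-cong (exnu a E)  p = c-nu (eplug-cong E p)

⟶-lift : ∀ E {A B} → A ⟶ B → eplug E A ⟶ eplug E B
⟶-lift E (r-comm E' C D a P Q) =
  subst₂ _⟶_ (eplug-⊚ E E' _) (eplug-⊚ E E' _) (r-comm (E ⊚ E') C D a P Q)
⟶-lift E (r-upd E' C D l P X Q R nc) =
  subst₂ _⟶_ (eplug-⊚ E E' _) (eplug-⊚ E E' _) (r-upd (E ⊚ E') C D l P X Q R nc)
⟶-lift E (r-str p r q) = r-str (eplug-cong E p) (⟶-lift E r) (eplug-cong E q)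

infix 4 _⟶⁺_
_⟶⁺_ : AProc → AProc → Set
_⟶⁺_ = TransClosure _⟶_

⟶⁺-lift : ∀ E {A B} → A ⟶⁺ B → eplug E A ⟶⁺ eplug E B
⟶⁺-lift E [ r ]    = [ ⟶-lift E r ]
⟶⁺-lift E (r ∷ rs) = ⟶-lift E r ∷ ⟶⁺-lift E rs

⟶⁺-restrict : ∀ bs {A B} → A ⟶⁺ B → restrict bs A ⟶⁺ restrict bs B
⟶⁺-restrict []       rs = rs
⟶⁺-restrict (b ∷ bs) rs = ⟶⁺-lift (exnu b ehole) (⟶⁺-restrict bs rs)

⟶⁺-resp-≈ : ∀ {A A' B' B} → A ≈ A' → A' ⟶⁺ B' → B' ≈ B → A ⟶⁺ B
⟶⁺-resp-≈ p [ r ]    q = [ r-str p r q ]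
⟶⁺-resp-≈ p (r ∷ rs) q = r-str p r ≈-refl ∷ ⟶⁺-resp-≈ ≈-refl rs q

⟶⁺⇒⟶* : ∀ {A B} → A ⟶⁺ B → A ⟶* B
⟶⁺⇒⟶* [ r ]    = r ◅ ε
⟶⁺⇒⟶* (r ∷ rs) = r ◅ ⟶⁺⇒⟶* rs

comm-step : ∀ a P Q X → apar (apar (apre (ain a) P) (apre (aout a) Q)) X ⟶ apar (apar P Q) X
comm-step a P Q X = r-comm (expar ehole X) hole hole a P Q

update-step : ∀ l P Y Q R X → NoCapture P Q →
  apar (apar (aloc l P) (aupd l Y Q R)) X ⟶ apar (apar (psub P Y Q) R) X
update-step l P Y Q R X nc = r-upd (expar ehole X) hole hole l P Y Q R nc

-- Only source names nm k are ever generated, so every other name is below every bound.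
Fresh : ℕ → TName → Set
Fresh M x = ∃[ k ] x ≡ nm k × M ≤ k

Below : ℕ → TName → Set
Below M x = ¬ Fresh M x

Fresh-mono : ∀ {M M' x} → M ≤ M' → Fresh M' x → Fresh M x
Fresh-mono M≤M' (k , x≡ , M'≤k) = k , x≡ , ℕ.≤-trans M≤M' M'≤k

Below-mono : ∀ {M M' x} → M ≤ M' → Below M x → Below M' x
Below-mono M≤M' x-below = x-below ∘ Fresh-mono M≤M'

pN-below : ∀ {M σ} → Below M (pN σ)
pN-below (_ , () , _)

nm-below-suc : ∀ c → Below (suc c) (nm c)
nm-below-suc c (_ , refl , c<c) = ℕ.<-irrefl refl c<c

nm∉below : ∀ {c xs} → All (Below c) xs → nm c ∉ xs
nm∉below h m = All.lookup h m (_ , refl , ℕ.≤-refl)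

fresh-below-disjoint : ∀ {M xs ys} → All (Fresh M) xs → All (Below M) ys → Disjoint xs ys
fresh-below-disjoint fs bs (m , m') = All.lookup bs m' (All.lookup fs m)

nameBound : TName → ℕ
nameBound (nm k) = suc k
nameBound _      = 0

bound : List TName → ℕ
bound = foldr (λ x m → nameBound x ⊔ m) 0

below-bound : ∀ xs → All (Below (bound xs)) xs
below-bound []       = []
below-bound (x ∷ xs) =
  below-head ∷ All.map (Below-mono (ℕ.m≤n⊔m (nameBound x) (bound xs))) (below-bound xs)
  where
  below-head : Below (nameBound x ⊔ bound xs) x
  below-head (k , refl , le) = ℕ.<-irrefl refl (ℕ.≤-trans (ℕ.m≤m⊔n (suc k) (bound xs)) le)

fresh : ℕ → AProc → AProc × ℕ
fresh c a0             = a0 , c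
fresh c (apre π A)     = let (A' , c') = fresh c A in apre π A' , c'
fresh c (arep A)       = let (A' , c') = fresh c A in arep A' , c'
fresh c (apar A B)     = let (A' , c₁) = fresh c A ; (B' , c₂) = fresh c₁ B in apar A' B' , c₂
fresh c (anu a A)      = let (A' , c') = fresh c A in anu (nm c') (ren a (nm c') A') , suc c'
fresh c (aloc l A)     = let (A' , c') = fresh c A in aloc l A' , c'
fresh c (aupd l X A B) = let (A' , c₁) = fresh c A ; (B' , c₂) = fresh c₁ B in aupd l X A' B' , c₂
fresh c (avar X)       = avar X , c

record Freshening (c : ℕ) (A D : AProc) (c' : ℕ) : Set where
  field
    α-equiv     : A ≈ D
    fn-⊆        : fn D ⊆ fn A
    fv-≡        : fv D ≡ fv A
    bn-fresh    : All (Fresh c) (bn D)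
    names-below : All (Below c') (names D)
    c≤c'        : c ≤ c'

fresh-spec : ∀ c A → All (Below c) (names A) → Freshening c A (proj₁ (fresh c A)) (proj₂ (fresh c A))
fresh-spec c a0 _ = record
  { α-equiv = ≈-refl ; fn-⊆ = id ; fv-≡ = refl ; bn-fresh = [] ; names-below = [] ; c≤c' = ℕ.≤-refl }
fresh-spec c (avar X) _ = record
  { α-equiv = ≈-refl ; fn-⊆ = id ; fv-≡ = refl ; bn-fresh = [] ; names-below = [] ; c≤c' = ℕ.≤-refl }
fresh-spec c (apre π A) (π-below ∷ h) = record
  { α-equiv = c-pre α-equiv ; fn-⊆ = ⊆.∷⁺ʳ (chan π) fn-⊆ ; fv-≡ = fv-≡ ; bn-fresh = bn-fresh
  ; names-below = Below-mono c≤c' π-below ∷ names-below ; c≤c' = c≤c' }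
  where open Freshening (fresh-spec c A h)
fresh-spec c (arep A) h = record
  { α-equiv = c-rep α-equiv ; fn-⊆ = fn-⊆ ; fv-≡ = fv-≡ ; bn-fresh = bn-fresh
  ; names-below = names-below ; c≤c' = c≤c' }
  where open Freshening (fresh-spec c A h)
fresh-spec c (aloc l A) (l-below ∷ h) = record
  { α-equiv = c-loc α-equiv ; fn-⊆ = ⊆.∷⁺ʳ l fn-⊆ ; fv-≡ = fv-≡ ; bn-fresh = bn-fresh
  ; names-below = Below-mono c≤c' l-below ∷ names-below ; c≤c' = c≤c' }
  where open Freshening (fresh-spec c A h)
fresh-spec c (apar A B) h = record
  { α-equiv = c-par (α-equiv S₁) (α-equiv S₂)
  ; fn-⊆ = ⊆.++⁺ (fn-⊆ S₁) (fn-⊆ S₂)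
  ; fv-≡ = cong₂ _++_ (fv-≡ S₁) (fv-≡ S₂)
  ; bn-fresh = ++⁺ (bn-fresh S₁) (All.map (Fresh-mono (c≤c' S₁)) (bn-fresh S₂))
  ; names-below = ++⁺ (All.map (Below-mono (c≤c' S₂)) (names-below S₁)) (names-below S₂)
  ; c≤c' = ℕ.≤-trans (c≤c' S₁) (c≤c' S₂) }
  where
  open Freshening
  S₁ = fresh-spec c A (++⁻ˡ (names A) h)
  S₂ = fresh-spec (proj₂ (fresh c A)) B (All.map (Below-mono (c≤c' S₁)) (++⁻ʳ (names A) h))
fresh-spec c (aupd l X A B) (l-below ∷ h) = record
  { α-equiv = c-upd (α-equiv S₁) (α-equiv S₂)
  ; fn-⊆ = ⊆.∷⁺ʳ l (⊆.++⁺ (fn-⊆ S₁) (fn-⊆ S₂))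
  ; fv-≡ = cong₂ _++_ (cong (removeV X) (fv-≡ S₁)) (fv-≡ S₂)
  ; bn-fresh = ++⁺ (bn-fresh S₁) (All.map (Fresh-mono (c≤c' S₁)) (bn-fresh S₂))
  ; names-below = Below-mono c≤c₂ l-below
                  ∷ ++⁺ (All.map (Below-mono (c≤c' S₂)) (names-below S₁)) (names-below S₂)
  ; c≤c' = c≤c₂ }
  where
  open Freshening
  S₁ = fresh-spec c A (++⁻ˡ (names A) h)
  S₂ = fresh-spec (proj₂ (fresh c A)) B (All.map (Below-mono (c≤c' S₁)) (++⁻ʳ (names A) h))
  c≤c₂ = ℕ.≤-trans (c≤c' S₁) (c≤c' S₂)
fresh-spec c (anu a A) (_ ∷ h) = record
  { α-equiv = ≈-trans (c-nu α-equiv) (alpha (nm∉below names-below))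
  ; fn-⊆ = λ m → fn-ν (∈-removeN⁻ (fn (ren a b A')) m)
  ; fv-≡ = trans (fv-ren a b A') fv-≡
  ; bn-fresh = (c₁ , refl , c≤c') ∷ subst (All (Fresh c)) (sym (bn-ren a b A')) bn-fresh
  ; names-below = nm-below-suc c₁ ∷ All.tabulate (names-ν ∘ ∈-names-ren⁻ a b A')
  ; c≤c' = ℕ.≤-trans c≤c' (ℕ.n≤1+n c₁) }
  where
  open Freshening (fresh-spec c A h)
  A' = proj₁ (fresh c A)
  c₁ = proj₂ (fresh c A)
  b = nm c₁
  fn-ν : ∀ {x} → x ≢ b × x ∈ fn (ren a b A') → x ∈ removeN a (fn A)
  fn-ν (x≢b , m) with ∈-fn-ren⁻ a b A' m
  ... | inj₁ x≡b        = ⊥-elim (x≢b x≡b)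
  ... | inj₂ (m' , x≢a) = ∈-removeN⁺ (fn A) x≢a (fn-⊆ m')
  names-ν : ∀ {x} → x ≡ b ⊎ x ∈ names A' → Below (suc c₁) x
  names-ν (inj₁ refl) = nm-below-suc c₁
  names-ν (inj₂ m)    = Below-mono (ℕ.n≤1+n c₁) (All.lookup names-below m)

freshen : ℕ → AProc → AProc
freshen c A = proj₁ (fresh c A)

Closed : AProc → Set
Closed A = ∀ X → X ∉ fv A

closed-par : ∀ A B → Closed A → Closed B → Closed (apar A B)
closed-par A B a-closed b-closed X m = Sum.[ a-closed X , b-closed X ] (∈-++⁻ (fv A) m)

closed-blocks : ∀ l Cs → All Closed Cs → Closed (blocks l Cs)
closed-blocks l []       []       X ()
closed-blocks l (C ∷ Cs) (h ∷ hs) = closed-par (aloc l C) (blocks l Cs) h (closed-blocks l Cs hs)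

record Admissible (M : ℕ) (D : AProc) : Set where
  field
    closed   : Closed D
    fn-below : All (Below M) (fn D)
    bn-fresh : All (Fresh M) (bn D)

admissible-freshen : ∀ {c C} → Closed C → All (Below c) (names C) → Admissible c (freshen c C)
admissible-freshen {c} {C} C-closed C-below = record
  { closed = λ X m → C-closed X (subst (X ∈_) fv-≡ m)
  ; fn-below = anti-mono (⊆.⊆-trans fn-⊆ (fn⊆names C)) C-below
  ; bn-fresh = bn-fresh }
  where open Freshening (fresh-spec c C C-below)

nocapture : ∀ {M D A} → Admissible M D → All (Fresh M) (bn A) → NoCapture D A
nocapture adm A-fresh =
  (λ a a∈fn a∈bn → All.lookup (fn-below adm) a∈fn (All.lookup A-fresh a∈bn)) ,
  (λ X X∈fv → ⊥-elim (closed adm X X∈fv))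
  where open Admissible

psub-∉fv : ∀ B X A → X ∉ fv A → psub B X A ≡ A
psub-∉fv B X a0 _ = refl
psub-∉fv B X (apre π A) h = cong (apre π) (psub-∉fv B X A h)
psub-∉fv B X (arep A) h = cong arep (psub-∉fv B X A h)
psub-∉fv B X (apar A A') h =
  cong₂ apar (psub-∉fv B X A (h ∘ ∈-++⁺ˡ)) (psub-∉fv B X A' (h ∘ ∈-++⁺ʳ (fv A)))
psub-∉fv B X (anu a A) h = cong (anu a) (psub-∉fv B X A h)
psub-∉fv B X (aloc l A) h = cong (aloc l) (psub-∉fv B X A h)
psub-∉fv B X (aupd l Y A A') h with X ℕ.≟ Y
... | yes _ = cong (aupd l Y A) (psub-∉fv B X A' (h ∘ ∈-++⁺ʳ (removeV Y (fv A))))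
... | no X≢Y = cong₂ (aupd l Y) (psub-∉fv B X A (h ∘ ∈-++⁺ˡ ∘ ∈-removeV⁺ (fv A) X≢Y))
                                (psub-∉fv B X A' (h ∘ ∈-++⁺ʳ (removeV Y (fv A))))
psub-∉fv B X (avar Y) h with X ℕ.≟ Y
... | yes X≡Y = ⊥-elim (h (here X≡Y))
... | no _    = refl

psub-closed : ∀ B X {A} → Closed A → psub B X A ≡ A
psub-closed B X {A} A-closed = psub-∉fv B X A (A-closed X)

map-psub-∉fv : ∀ B X As → All (λ A → X ∉ fv A) As → map (psub B X) As ≡ As
map-psub-∉fv B X []       []       = refl
map-psub-∉fv B X (A ∷ As) (h ∷ hs) = cong₂ _∷_ (psub-∉fv B X A h) (map-psub-∉fv B X As hs)

∉fv-avars : ∀ {X} ys → X ∉ ys → All (λ A → X ∉ fv A) (map avar ys)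
∉fv-avars []       _   = []
∉fv-avars (y ∷ ys) X∉ = (λ { (here X≡y) → X∉ (here X≡y) }) ∷ ∉fv-avars ys (X∉ ∘ there)

psub-var : ∀ B X → psub B X (avar X) ≡ B
psub-var B X with X ℕ.≟ X
... | yes _  = refl
... | no X≢X = ⊥-elim (X≢X refl)

psub-nestBody : ∀ B X l xs Z → X ∉ xs → psub B X (nestBody l xs Z) ≡ nestBody l xs (psub B X Z)
psub-nestBody B X l []       Z _  = refl
psub-nestBody B X l (y ∷ ys) Z X∉ with X ℕ.≟ y
... | yes X≡y = ⊥-elim (X∉ (here X≡y))
... | no _    = cong (λ A → aupd l y A a0) (psub-nestBody B X l ys Z (X∉ ∘ there))

psub-zupd : ∀ B X Z → X ≢ 0 → psub B X (zupd Z) ≡ zupd (psub B X Z)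
psub-zupd B X Z X≢0 with X ℕ.≟ 0
... | yes X≡0 = ⊥-elim (X≢0 X≡0)
... | no _    = refl

psub-blocks : ∀ B X l Cs → psub B X (blocks l Cs) ≡ blocks l (map (psub B X) Cs)
psub-blocks B X l []       = refl
psub-blocks B X l (C ∷ Cs) = cong (apar (aloc l (psub B X C))) (psub-blocks B X l Cs)

fv-nestBody : ∀ l xs Z {X} → X ∈ fv (nestBody l xs Z) → X ∈ fv Z × X ∉ xs
fv-nestBody l []       Z m = m , λ ()
fv-nestBody l (y ∷ ys) Z m with ∈-removeV⁻ (fv (nestBody l ys Z)) (subst (_ ∈_) (++-identityʳ _) m)
... | X≢y , m' with fv-nestBody l ys Z m'
...   | m'' , X∉ys = m'' , λ { (here X≡y) → X≢y X≡y ; (there X∈ys) → X∉ys X∈ys }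

bn-nestBody : ∀ l xs Z → bn (nestBody l xs Z) ≡ bn Z
bn-nestBody l []       Z = refl
bn-nestBody l (x ∷ xs) Z = trans (++-identityʳ _) (bn-nestBody l xs Z)

∈-fv-slots : ∀ l e xs {X} → X ∈ fv (foldr (λ x acc → apar (aloc l (avar x)) acc) e xs) → X ∈ xs ⊎ X ∈ fv e
∈-fv-slots l e []       m          = inj₂ m
∈-fv-slots l e (x ∷ xs) (here X≡x) = inj₁ (here X≡x)
∈-fv-slots l e (x ∷ xs) (there m)  = Sum.map₁ there (∈-fv-slots l e xs m)

aux-closed : ∀ n t ρ {Q'} → Closed Q' → Closed (aux n t ρ Q')
aux-closed zero t ρ {Q'} Q'-closed X m = Q'-closed X (subst (X ∈_) (++-identityʳ (fv Q')) m)
aux-closed (suc n) t ρ {Q'} Q'-closed X m =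
  let (X≢1 , m₁)  = ∈-removeV⁻ {a = 1} (fv (nestBody pt xs (zupd slots))) (subst (X ∈_) (++-identityʳ _) m)
      (m₂ , X∉xs) = fv-nestBody pt xs (zupd slots) m₁
      m₃          = proj₂ (∈-removeV⁻ {a = 0} (fv slots) (subst (X ∈_) (++-identityʳ _) m₂))
  in Sum.[ (λ m₄ → Sum.[ X≢1 , X∉xs ] (∈-vars-suc⁻ n m₄)) , Q'-closed X ] (∈-fv-slots (pN ρ) e (vars (suc n)) m₃)
  where
  pt = pN (t ∷ ρ)
  xs = map suc (vars n)
  e = apre (aout (mN t)) (aloc (pN ρ) Q')
  slots = foldr (λ x acc → apar (aloc (pN ρ) (avar x)) acc) e (vars (suc n))

enc-closed : ∀ ρ P → Closed (enc ρ P)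
enc-closed ρ c0 X ()
enc-closed ρ (cpre π P) = enc-closed ρ P
enc-closed ρ (crep P) = enc-closed ρ P
enc-closed ρ (cpar P Q) = closed-par (enc ρ P) (enc ρ Q) (enc-closed ρ P) (enc-closed ρ Q)
enc-closed ρ (cnu a P) = enc-closed ρ P
enc-closed ρ (ctr t P Q) =
  closed-par (apar (aloc (nm t) (enc (t ∷ ρ) P)) (aux (npb P) t ρ (enc [] Q))) (apre (aout (lN t)) (apre (ain (kN t)) a0))
    (closed-par (aloc (nm t) (enc (t ∷ ρ) P)) (aux (npb P) t ρ (enc [] Q)) (enc-closed (t ∷ ρ) P) (aux-closed (npb P) t ρ (enc-closed [] Q))) (λ X ())
enc-closed ρ (cpb P) = enc-closed [] P

extrD-npb-zero : ∀ ρ P → npb P ≡ 0 → enc ρ (extrD P) ≈ a0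
extrD-npb-zero ρ c0 _ = ≈-refl
extrD-npb-zero ρ (cpre π P) _ = ≈-refl
extrD-npb-zero ρ (crep P) _ = ≈-refl
extrD-npb-zero ρ (cpar P Q) np =
  ≈-trans (c-par (extrD-npb-zero ρ P (ℕ.m+n≡0⇒m≡0 (npb P) np))
                 (extrD-npb-zero ρ Q (ℕ.m+n≡0⇒n≡0 (npb P) np))) par-unit
extrD-npb-zero ρ (cnu a P) np = ≈-trans (c-nu (extrD-npb-zero ρ P np)) nu-zero
extrD-npb-zero ρ (ctr t P Q) _ = ≈-refl
extrD-npb-zero ρ (cpb P) ()

InScope : ℕ → List TName → TName → Set
InScope N bs x = Below N x ⊎ x ∈ bs

Scoped : ℕ → List TName → AProc → Set
Scoped N bs A = All (InScope N bs) (names A)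

scoped-below : ∀ {N M bs} A → N ≤ M → All (Below M) bs → Scoped N bs A → All (Below M) (names A)
scoped-below A N≤M bs-below = All.map Sum.[ Below-mono N≤M , All.lookup bs-below ]

fn-restrict-below : ∀ {N} bs A → Scoped N bs A → All (Below N) (fn (restrict bs A))
fn-restrict-below bs A h = All.tabulate λ m →
  let (m' , x∉bs) = ∈-fn-restrict⁻ bs A m in Sum.[ id , ⊥-elim ∘ x∉bs ] (All.lookup h (fn⊆names A m'))

scoped-ren : ∀ {N bs a b} A → Scoped N bs A → Scoped N (b ∷ bs) (ren a b A)
scoped-ren {a = a} {b} A h =
  All.tabulate λ m → Sum.[ (λ x≡b → inj₂ (here x≡b)) , (λ m' → Sum.map₂ there (All.lookup h m')) ] (∈-names-ren⁻ a b A m)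

record Extraction (N : ℕ) (σ ρ : Path) (c : ℕ) (P : CProc) : Set where
  field
    bs        : List TName
    Cs        : List AProc
    R         : AProc
    c'        : ℕ
    enc-≈     : enc σ P ≈ restrict bs (apar (blocks (pN σ) Cs) R)
    extrD-≈   : enc ρ (extrD P) ≈ restrict bs (blocks (pN ρ) Cs)
    length-Cs : length Cs ≡ npb P
    bs-fresh  : All (Fresh c) bs
    bs-below  : All (Below c') bs
    Cs-scoped : All (Scoped N bs) Cs
    R-scoped  : Scoped N bs R
    Cs-closed : All Closed Cs
    c≤c'      : c ≤ c'

  scoped : ∀ l → Scoped N bs (apar (blocks (pN l) Cs) R)
  scoped l = ++⁺ (names-blocks (pN l) Cs (inj₁ pN-below) Cs-scoped) R-scoped

extraction-inert : ∀ {N} σ ρ c P → extrD P ≡ c0 → npb P ≡ 0 → All (Below N) (names (enc σ P)) →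
  Extraction N σ ρ c P
extraction-inert σ ρ c P extr≡ np h = record
  { bs = [] ; Cs = [] ; R = enc σ P ; c' = c
  ; enc-≈ = ≈-sym par-unitˡ ; extrD-≈ = ≈-reflexive (cong (enc ρ) extr≡) ; length-Cs = sym np
  ; bs-fresh = [] ; bs-below = [] ; Cs-scoped = [] ; R-scoped = All.map inj₁ h ; Cs-closed = []
  ; c≤c' = ℕ.≤-refl }

extraction-block : ∀ {N} σ ρ c P → All (Below N) (names (enc [] P)) → Extraction N σ ρ c (cpb P)
extraction-block σ ρ c P h = record
  { bs = [] ; Cs = enc [] P ∷ [] ; R = a0 ; c' = c
  ; enc-≈ = ≈-sym (≈-trans par-unit par-unit) ; extrD-≈ = ≈-sym par-unit ; length-Cs = refl
  ; bs-fresh = [] ; bs-below = [] ; Cs-scoped = All.map inj₁ h ∷ [] ; R-scoped = []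
  ; Cs-closed = enc-closed [] P ∷ [] ; c≤c' = ℕ.≤-refl }

extraction-ν : ∀ {N σ ρ c a P} → N ≤ c → Below N (nm a) → Extraction N σ ρ c P → Extraction N σ ρ c (cnu a P)
extraction-ν {N} {σ} {ρ} {c} {a} N≤c a-below X = record
  { bs = b ∷ bs ; Cs = map (ren (nm a) b) Cs ; R = ren (nm a) b R ; c' = suc c'
  ; enc-≈ = ≈-trans (c-nu enc-≈)
              (≈-trans (alpha-restrict bs (apar (blocks (pN σ) Cs) R) b∉bs (b∉ σ) a∉bs)
                       (≈-reflexive (cong (λ B → anu b (restrict bs (apar B (ren (nm a) b R))))
                                          (ren-blocks b Cs λ ()))))
  ; extrD-≈ = ≈-trans (c-nu extrD-≈)
                (≈-trans (alpha-restrict bs (blocks (pN ρ) Cs) b∉bs (b∉ ρ ∘ ∈-++⁺ˡ) a∉bs)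
                         (≈-reflexive (cong (anu b ∘ restrict bs) (ren-blocks b Cs λ ()))))
  ; length-Cs = trans (length-map _ Cs) length-Cs
  ; bs-fresh = (c' , refl , c≤c') ∷ bs-fresh
  ; bs-below = nm-below-suc c' ∷ All.map (Below-mono (ℕ.n≤1+n c')) bs-below
  ; Cs-scoped = All-map⁺ (All.map (λ {C} → scoped-ren {a = nm a} {b} C) Cs-scoped)
  ; R-scoped = scoped-ren R R-scoped
  ; Cs-closed = All-map⁺ (All.map (λ {C} C-closed X → C-closed X ∘ subst (X ∈_) (fv-ren (nm a) b C)) Cs-closed)
  ; c≤c' = ℕ.≤-trans c≤c' (ℕ.n≤1+n c') }
  where
  open Extraction X
  b = nm c'
  b∉bs : b ∉ bs
  b∉bs = nm∉below bs-below
  b∉ : ∀ l → b ∉ names (apar (blocks (pN l) Cs) R)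
  b∉ l = nm∉below (scoped-below (apar (blocks (pN l) Cs) R) (ℕ.≤-trans N≤c c≤c') bs-below (scoped l))
  a∉bs : All (nm a ≢_) bs
  a∉bs = All.map (λ y-fresh a≡y → a-below (subst (Fresh N) (sym a≡y) (Fresh-mono N≤c y-fresh))) bs-fresh

extraction-par : ∀ {N σ ρ c P₁ P₂} → N ≤ c → (X₁ : Extraction N σ ρ c P₁) →
  Extraction N σ ρ (Extraction.c' X₁) P₂ → Extraction N σ ρ c (cpar P₁ P₂)
extraction-par {N} {σ} {ρ} N≤c X₁ X₂ = record
  { bs = bs X₁ ++ bs X₂ ; Cs = Cs X₁ ++ Cs X₂ ; R = apar (R X₁) (R X₂) ; c' = c' X₂
  ; enc-≈ = ≈-trans (c-par (enc-≈ X₁) (enc-≈ X₂))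
              (≈-trans (restrict-par (bs X₁) (bs X₂) (disjoint₁ (apar (blocks (pN σ) (Cs X₂)) (R X₂)) (scoped X₂ σ))
                                                     (disjoint₂ (apar (blocks (pN σ) (Cs X₁)) (R X₁)) (scoped X₁ σ)))
                       (restrict-cong (bs X₁ ++ bs X₂)
                         (≈-trans (solve 4 (λ b₁ r₁ b₂ r₂ → (b₁ ⊕ r₁) ⊕ (b₂ ⊕ r₂) ⊜ (b₁ ⊕ b₂) ⊕ (r₁ ⊕ r₂))
                                          ≈-refl _ _ _ _)
                                  (c-par (≈-sym (blocks-++ (pN σ) (Cs X₁) (Cs X₂))) ≈-refl))))
  ; extrD-≈ = ≈-trans (c-par (extrD-≈ X₁) (extrD-≈ X₂))
                (≈-trans (restrict-par (bs X₁) (bs X₂) (disjoint₁ (blocks (pN ρ) (Cs X₂)) (blocks-scoped X₂))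
                                                       (disjoint₂ (blocks (pN ρ) (Cs X₁)) (blocks-scoped X₁)))
                         (restrict-cong (bs X₁ ++ bs X₂) (≈-sym (blocks-++ (pN ρ) (Cs X₁) (Cs X₂)))))
  ; length-Cs = trans (length-++ (Cs X₁)) (cong₂ _+_ (length-Cs X₁) (length-Cs X₂))
  ; bs-fresh = ++⁺ (bs-fresh X₁) (All.map (Fresh-mono (c≤c' X₁)) (bs-fresh X₂))
  ; bs-below = ++⁺ (All.map (Below-mono (c≤c' X₂)) (bs-below X₁)) (bs-below X₂)
  ; Cs-scoped = ++⁺ (All.map widenˡ (Cs-scoped X₁)) (All.map widenʳ (Cs-scoped X₂))
  ; R-scoped = ++⁺ (widenˡ (R-scoped X₁)) (widenʳ (R-scoped X₂))
  ; Cs-closed = ++⁺ (Cs-closed X₁) (Cs-closed X₂)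
  ; c≤c' = ℕ.≤-trans (c≤c' X₁) (c≤c' X₂) }
  where
  open Extraction
  widenˡ : ∀ {xs} → All (InScope N (bs X₁)) xs → All (InScope N (bs X₁ ++ bs X₂)) xs
  widenˡ = All.map (Sum.map₂ ∈-++⁺ˡ)
  widenʳ : ∀ {xs} → All (InScope N (bs X₂)) xs → All (InScope N (bs X₁ ++ bs X₂)) xs
  widenʳ = All.map (Sum.map₂ (∈-++⁺ʳ (bs X₁)))
  blocks-scoped : ∀ {c P} (X : Extraction N σ ρ c P) → Scoped N (bs X) (blocks (pN ρ) (Cs X))
  blocks-scoped X = names-blocks (pN ρ) (Cs X) (inj₁ pN-below) (Cs-scoped X)
  disjoint₁ : ∀ A → Scoped N (bs X₂) A → Disjoint (bs X₁) (fn (restrict (bs X₂) A))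
  disjoint₁ A h = fresh-below-disjoint (All.map (Fresh-mono N≤c) (bs-fresh X₁)) (fn-restrict-below (bs X₂) A h)
  disjoint₂ : ∀ A → Scoped N (bs X₁) A → Disjoint (bs X₂) (fn A)
  disjoint₂ A h = fresh-below-disjoint (bs-fresh X₂)
    (anti-mono (fn⊆names A) (scoped-below A (ℕ.≤-trans N≤c (c≤c' X₁)) (bs-below X₁) h))

extraction : ∀ {N} σ ρ c P → N ≤ c → All (Below N) (names (enc σ P)) → Extraction N σ ρ c P
extraction σ ρ c c0 _ h = extraction-inert σ ρ c c0 refl refl h
extraction σ ρ c (cpre π P) _ h = extraction-inert σ ρ c (cpre π P) refl refl h
extraction σ ρ c (crep P) _ h = extraction-inert σ ρ c (crep P) refl refl h
extraction σ ρ c (ctr t P Q) _ h = extraction-inert σ ρ c (ctr t P Q) refl refl h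
extraction σ ρ c (cpb P) _ (_ ∷ h) = extraction-block σ ρ c P h
extraction σ ρ c (cnu a P) N≤c (a-below ∷ h) = extraction-ν N≤c a-below (extraction σ ρ c P N≤c h)
extraction σ ρ c (cpar P₁ P₂) N≤c h = extraction-par N≤c X₁
  (extraction σ ρ (Extraction.c' X₁) P₂ (ℕ.≤-trans N≤c (Extraction.c≤c' X₁)) (++⁻ʳ (names (enc σ P₁)) h))
  where X₁ = extraction σ ρ c P₁ N≤c (++⁻ˡ (names (enc σ P₁)) h)

module Transaction (t : ℕ) (ρ : Path) where

  T pt pρ : TName
  T  = nm t
  pt = pN (t ∷ ρ)
  pρ = pN ρ

  waitK trigger killer : AProc
  waitK   = apre (ain (kN t)) a0
  trigger = apre (aout (lN t)) waitK
  killer  = apre (ain (mN t)) (apre (aout (kN t)) (kill T))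

  release : AProc → AProc
  release Q' = apre (aout (mN t)) (aloc pρ Q')

  finish : ∀ Q' R X → apar (apar (release Q') killer) (apar waitK (apar (aloc T R) X)) ⟶⁺ apar (aloc pρ Q') X
  finish Q' R X =
    r-str (c-par par-comm ≈-refl) (comm-step (mN t) K L _) ≈-refl ∷
    r-str (solve 5 (λ k l w r x → (k ⊕ l) ⊕ (w ⊕ (r ⊕ x)) ⊜ (w ⊕ k) ⊕ (l ⊕ (r ⊕ x))) ≈-refl K L waitK TR X)
          (comm-step (kN t) a0 (kill T) _) ≈-refl ∷
    [ r-str (solve 4 (λ k l r x → (∅ ⊕ k) ⊕ (l ⊕ (r ⊕ x)) ⊜ (r ⊕ k) ⊕ (l ⊕ x)) ≈-refl (kill T) L TR X)
            (update-step T R 0 a0 a0 (apar L X) ((λ _ _ ()) , (λ _ _ ())))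
            (solve 2 (λ l x → (∅ ⊕ ∅) ⊕ (l ⊕ x) ⊜ l ⊕ x) ≈-refl L X) ]
    where
    K = apre (aout (kN t)) (kill T)
    L = aloc pρ Q'
    TR = aloc T R

  run-zero : ∀ E Q' → apar (apar (aloc T E) (aux 0 t ρ Q')) trigger ⟶⁺ apar (aloc pρ Q') a0
  run-zero E Q' =
    r-str (solve 4 (λ e l k g → (e ⊕ (l ⊕ k)) ⊕ g ⊜ (l ⊕ g) ⊕ (k ⊕ e)) ≈-refl
                   (aloc T E) (apre (ain (lN t)) (release Q')) killer trigger)
          (comm-step (lN t) (release Q') waitK (apar killer (aloc T E)))
          (solve 4 (λ r w k e → (r ⊕ w) ⊕ (k ⊕ e) ⊜ (r ⊕ k) ⊕ (w ⊕ (e ⊕ ∅))) ≈-refl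
                   (release Q') waitK killer (aloc T E))
    ∷ finish Q' E a0

  -- t[·] during the collection: pending update, uncollected blocks, rest of the default activity.
  collecting : AProc → List AProc → AProc → AProc
  collecting U Ds R = apar (apar U (blocks pt Ds)) R

  module Collection (Q' : AProc) (M : ℕ) (Q'-admissible : Admissible M Q') where

    open Admissible

    collector : List PVar → List AProc → AProc
    collector xs S = nestBody pt xs (zupd (apar (blocks pρ S) (release Q')))

    continuation : AProc
    continuation = apar (aloc zN a0) killer

    aux-≈ : ∀ n {Q} → Q ≈ Q' → aux (suc n) t ρ Q ≈
      apre (ain (lN t)) (aupd pt 1 (collector (map suc (vars n)) (map avar (1 ∷ map suc (vars n)))) continuation)
    aux-≈ n {Q} Q≈Q' = c-pre (c-upd (nestBody-cong pt (map suc (vars n)) (c-upd slots ≈-refl)) ≈-refl)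
      where
      slots : foldr (λ x acc → apar (aloc pρ (avar x)) acc) (release Q) (vars (suc n))
              ≈ apar (blocks pρ (map avar (1 ∷ map suc (vars n)))) (release Q')
      slots = ≈-trans (slots-≈ pρ (vars (suc n)) (c-pre (c-loc Q≈Q')))
                      (≈-reflexive (cong (λ vs → apar (blocks pρ (map avar vs)) (release Q')) (vars-suc n)))

    slots-fresh : ∀ {done} → All (Admissible M) done → ∀ ys → All (All (Fresh M) ∘ bn) (done ++ map avar ys)
    slots-fresh done-admissible ys =
      ++⁺ (All.map bn-fresh done-admissible) (All-map⁺ (All.universal (λ _ → []) ys))

    collector-fresh : ∀ xs S → All (All (Fresh M) ∘ bn) S → All (Fresh M) (bn (collector xs S))
    collector-fresh xs S S-fresh =
      subst (All (Fresh M)) (sym (bn-nestBody pt xs _))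
            (++⁺ (++⁺ (bn-blocks pρ S S-fresh) (bn-fresh Q'-admissible)) [])

    psub-collector : ∀ D x xs done → All Closed done → x ≢ 0 → x ∉ xs →
      psub D x (collector xs (done ++ avar x ∷ map avar xs)) ≡ collector xs ((done ++ D ∷ []) ++ map avar xs)
    psub-collector D x xs done done-closed x≢0 x∉xs = begin
      psub D x (collector xs S)
        ≡⟨ psub-nestBody D x pt xs _ x∉xs ⟩
      nestBody pt xs (psub D x (zupd (apar (blocks pρ S) (release Q'))))
        ≡⟨ cong (nestBody pt xs) (psub-zupd D x _ x≢0) ⟩
      nestBody pt xs (zupd (apar (psub D x (blocks pρ S)) (psub D x (release Q'))))
        ≡⟨ cong₂ (λ B E → nestBody pt xs (zupd (apar B E)))
                 (psub-blocks D x pρ S) (psub-closed D x (closed Q'-admissible)) ⟩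
      collector xs (map (psub D x) S)
        ≡⟨ cong (collector xs) slots ⟩
      collector xs ((done ++ D ∷ []) ++ map avar xs) ∎
      where
      open ≡-Reasoning
      S = done ++ avar x ∷ map avar xs
      slots : map (psub D x) S ≡ (done ++ D ∷ []) ++ map avar xs
      slots = begin
        map (psub D x) S
          ≡⟨ map-++ (psub D x) done (avar x ∷ map avar xs) ⟩
        map (psub D x) done ++ psub D x (avar x) ∷ map (psub D x) (map avar xs)
          ≡⟨ cong₂ _++_ (map-psub-∉fv D x done (All.map (λ C-closed → C-closed x) done-closed))
                        (cong₂ _∷_ (psub-var D x) (map-psub-∉fv D x (map avar xs) (∉fv-avars xs x∉xs))) ⟩
        done ++ D ∷ map avar xs
          ≡⟨ sym (++-assoc done (D ∷ []) (map avar xs)) ⟩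
        (done ++ D ∷ []) ++ map avar xs ∎

    -- xs are the variables of the slots still to be filled; 0 is bound by the update on z.
    collect : ∀ xs done Ds R → length Ds ≡ length xs → Unique xs → 0 ∉ xs →
      All (Admissible M) done → All (Admissible M) Ds →
      apar (aloc T (collecting (collector xs (done ++ map avar xs)) Ds R)) (aloc zN a0)
        ⟶⁺ apar (apar (blocks pρ (done ++ Ds)) (release Q')) (aloc T (collecting a0 [] R))
    collect [] done [] R _ _ _ done-admissible [] =
      [ r-str par-comm
              (r-upd ehole hole (cxloc T (cxpar (cxpar hole a0) R)) zN a0 0 G a0 ((λ _ ()) , (λ _ ())))
              (≈-reflexive (cong (λ A → apar A (aloc T (collecting a0 [] R))) (psub-closed a0 0 G-closed))) ]
      where
      G = apar (blocks pρ (done ++ [])) (release Q')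
      G-closed : Closed G
      G-closed = closed-par (blocks pρ (done ++ [])) (release Q')
        (closed-blocks pρ (done ++ []) (++⁺ (All.map closed done-admissible) [])) (closed Q'-admissible)
    collect (x ∷ xs) done (D ∷ Ds) R len (x≢xs ∷ xs-unique) 0∉ done-admissible (D-admissible ∷ Ds-admissible) =
      r-str (c-par (c-loc (solve 4 (λ u d b r → (u ⊕ (d ⊕ b)) ⊕ r ⊜ d ⊕ (u ⊕ (b ⊕ r))) ≈-refl
                                  (aupd pt x Body a0) (aloc pt D) (blocks pt Ds) R)) ≈-refl)
            (r-upd (expar (exloc T ehole) (aloc zN a0)) hole (cxpar hole (apar (blocks pt Ds) R)) pt D x Body a0
                   (nocapture {A = Body} D-admissible
                      (collector-fresh xs (done ++ map avar (x ∷ xs)) (slots-fresh done-admissible (x ∷ xs)))))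
            (c-par (c-loc (≈-trans (c-par (≈-reflexive filled) ≈-refl)
                                   (solve 3 (λ u b r → u ⊕ (∅ ⊕ (b ⊕ r)) ⊜ (u ⊕ b) ⊕ r) ≈-refl _ (blocks pt Ds) R)))
                   ≈-refl)
      ∷ subst (λ S → apar (aloc T (collecting (collector xs ((done ++ D ∷ []) ++ map avar xs)) Ds R)) (aloc zN a0)
                       ⟶⁺ apar (apar (blocks pρ S) (release Q')) (aloc T (collecting a0 [] R)))
              (++-assoc done (D ∷ []) Ds)
              (collect xs (done ++ D ∷ []) Ds R (ℕ.suc-injective len) xs-unique (0∉ ∘ there)
                       (++⁺ done-admissible (D-admissible ∷ [])) Ds-admissible)
      where
      Body = collector xs (done ++ avar x ∷ map avar xs)
      filled : psub D x Body ≡ collector xs ((done ++ D ∷ []) ++ map avar xs)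
      filled = psub-collector D x xs done (All.map closed done-admissible)
                              (λ x≡0 → 0∉ (here (sym x≡0))) (All¬⇒¬Any x≢xs)

    enter : ∀ {Q} m D Ds R → Q ≈ Q' → Admissible M D →
      apar (apar (aloc T (apar (blocks pt (D ∷ Ds)) R)) (aux (suc m) t ρ Q)) trigger
        ⟶⁺ apar (apar (aloc T (collecting (collector (map suc (vars m)) (D ∷ map avar (map suc (vars m)))) Ds R))
                       (aloc zN a0))
                 (apar killer waitK)
    enter m D Ds R Q≈Q' D-admissible =
      r-str (≈-trans (c-par (c-par ≈-refl (aux-≈ m Q≈Q')) ≈-refl)
                     (solve 3 (λ w a g → (w ⊕ a) ⊕ g ⊜ (a ⊕ g) ⊕ w) ≈-refl (aloc T W) _ trigger))
            (comm-step (lN t) U waitK (aloc T W))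
            (solve 3 (λ u k w → (u ⊕ k) ⊕ w ⊜ (w ⊕ u) ⊕ k) ≈-refl U waitK (aloc T W))
      ∷ [ r-str ≈-refl
                (r-upd (expar ehole waitK) (cxloc T (cxpar (cxpar hole (blocks pt Ds)) R)) hole pt D 1 Body continuation
                       (nocapture {A = Body} D-admissible
                                  (collector-fresh xs (map avar (1 ∷ xs)) (slots-fresh [] (1 ∷ xs)))))
                (≈-trans (c-par (c-par (c-loc (c-par (c-par (≈-reflexive filled) ≈-refl) ≈-refl)) ≈-refl) ≈-refl)
                         (solve 4 (λ a z k w → (a ⊕ (z ⊕ k)) ⊕ w ⊜ (a ⊕ z) ⊕ (k ⊕ w)) ≈-refl
                                _ (aloc zN a0) killer waitK)) ]
      where
      xs = map suc (vars m)
      Body = collector xs (avar 1 ∷ map avar xs)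
      U = aupd pt 1 Body continuation
      W = apar (blocks pt (D ∷ Ds)) R
      filled : psub D 1 Body ≡ collector xs (D ∷ map avar xs)
      filled = psub-collector D 1 xs [] [] (λ ()) (proj₁ (unique-later-vars m))

    run-suc : ∀ {Q} m Ds R → length Ds ≡ suc m → Q ≈ Q' → All (Admissible M) Ds →
      apar (apar (aloc T (apar (blocks pt Ds) R)) (aux (suc m) t ρ Q)) trigger ⟶⁺ apar (aloc pρ Q') (blocks pρ Ds)
    run-suc m (D ∷ Ds) R len Q≈Q' (D-admissible ∷ Ds-admissible) =
      enter m D Ds R Q≈Q' D-admissible
      ◅◅⁺ ⟶⁺-lift (expar ehole (apar killer waitK))
                  (collect xs (D ∷ []) Ds R length-Ds (proj₂ (unique-later-vars m)) (0∉map-suc (vars m))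
                           (D-admissible ∷ []) Ds-admissible)
      ◅◅⁺ ⟶⁺-resp-≈ (solve 5 (λ b r c k w → ((b ⊕ r) ⊕ c) ⊕ (k ⊕ w) ⊜ (r ⊕ k) ⊕ (w ⊕ (c ⊕ b))) ≈-refl
                              (blocks pρ (D ∷ Ds)) (release Q') (aloc T (collecting a0 [] R)) killer waitK)
                    (finish Q' (collecting a0 [] R) (blocks pρ (D ∷ Ds))) ≈-refl
      where
      xs = map suc (vars m)
      length-Ds : length Ds ≡ length xs
      length-Ds = trans (ℕ.suc-injective len) (sym (trans (length-map suc (vars m)) (length-vars m)))

compensate : ∀ t ρ P Q m → npb P ≡ suc m →
  apar (apar (aloc (nm t) (enc (t ∷ ρ) P)) (aux (suc m) t ρ (enc [] Q))) (Transaction.trigger t ρ)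
    ⟶⁺ apar (enc ρ (extrD P)) (aloc (pN ρ) (enc [] Q))
compensate t ρ P Q m np =
  ⟶⁺-resp-≈ pre (⟶⁺-restrict bs (run-suc m Ds R length-Ds (Freshening.α-equiv Q-freshening) Ds-admissible)) post
  where
  open Transaction t ρ
  E = enc (t ∷ ρ) P
  Q₀ = enc [] Q
  A₀ = aux (suc m) t ρ Q₀
  TEA = apar (aloc T E) A₀
  N = bound (names (apar TEA trigger) ++ names Q₀)
  all-below = below-bound (names (apar TEA trigger) ++ names Q₀)
  TEA-below : All (Below N) (names TEA)
  TEA-below = ++⁻ˡ (names TEA) (++⁻ˡ (names (apar TEA trigger)) all-below)
  trigger-below : All (Below N) (names trigger)
  trigger-below = ++⁻ʳ (names TEA) (++⁻ˡ (names (apar TEA trigger)) all-below)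
  Q₀-below : All (Below N) (names Q₀)
  Q₀-below = ++⁻ʳ (names (apar TEA trigger)) all-below

  open Extraction (extraction (t ∷ ρ) ρ N P ℕ.≤-refl (++⁻ˡ (names E) (All.tail TEA-below)))
  -- Blocks and compensation may all be renamed from the same index c': only clashes between
  -- free and bound names matter.
  Ds = map (freshen c') Cs
  Q-freshening : Freshening c' Q₀ (freshen c' Q₀) (proj₂ (fresh c' Q₀))
  Q-freshening = fresh-spec c' Q₀ (All.map (Below-mono c≤c') Q₀-below)
  open Collection (freshen c' Q₀) c' (admissible-freshen {C = Q₀} (enc-closed [] Q) (All.map (Below-mono c≤c') Q₀-below))

  Cs-below : All (All (Below c') ∘ names) Cs
  Cs-below = All.map (λ {C} → scoped-below C c≤c' bs-below) Cs-scoped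
  Ds-admissible : All (Admissible c') Ds
  Ds-admissible = All-map⁺ (All.zipWith (λ {C} → uncurry (admissible-freshen {C = C})) (Cs-closed , Cs-below))
  length-Ds : length Ds ≡ suc m
  length-Ds = trans (length-map _ Cs) (trans length-Cs np)
  freshened : ∀ l → blocks l Cs ≈ blocks l Ds
  freshened l = blocks-map l Cs (All.map (λ {C} h → Freshening.α-equiv (fresh-spec c' C h)) Cs-below)

  apart : ∀ A → All (Below N) (names A) → Disjoint bs (fn A)
  apart A h = fresh-below-disjoint bs-fresh (anti-mono (fn⊆names A) h)
  T∉bs : All (_≢ T) bs
  T∉bs = All.map (λ b-fresh b≡T → All.head TEA-below (subst (Fresh N) b≡T b-fresh)) bs-fresh

  open ≈-Reasoning
  pre : apar TEA trigger ≈ restrict bs (apar (apar (aloc T (apar (blocks pt Ds) R)) A₀) trigger)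
  pre = begin
    apar TEA trigger
      ≈⟨ c-par (c-par (c-loc enc-≈) ≈-refl) ≈-refl ⟩
    apar (apar (aloc T (restrict bs (apar (blocks pt Cs) R))) A₀) trigger
      ≈⟨ extrude-restrict bs T∉bs (apart A₀ (++⁻ʳ (names E) (All.tail TEA-below))) (apart trigger trigger-below) ⟩
    restrict bs (apar (apar (aloc T (apar (blocks pt Cs) R)) A₀) trigger)
      ≈⟨ restrict-cong bs (c-par (c-par (c-loc (c-par (freshened pt) ≈-refl)) ≈-refl) ≈-refl) ⟩
    restrict bs (apar (apar (aloc T (apar (blocks pt Ds) R)) A₀) trigger) ∎
  post : restrict bs (apar (aloc pρ (freshen c' Q₀)) (blocks pρ Ds)) ≈ apar (enc ρ (extrD P)) (aloc pρ Q₀)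
  post = begin
    restrict bs (apar (aloc pρ (freshen c' Q₀)) (blocks pρ Ds))
      ≈⟨ restrict-cong bs (≈-trans par-comm
           (c-par (≈-sym (freshened pρ)) (c-loc (≈-sym (Freshening.α-equiv Q-freshening))))) ⟩
    restrict bs (apar (blocks pρ Cs) (aloc pρ Q₀))
      ≈⟨ ≈-sym (restrict-parʳ bs (apart (aloc pρ Q₀) (pN-below ∷ Q₀-below))) ⟩
    apar (restrict bs (blocks pρ Cs)) (aloc pρ Q₀)
      ≈⟨ c-par (≈-sym extrD-≈) ≈-refl ⟩
    apar (enc ρ (extrD P)) (aloc pρ Q₀) ∎

lemma1 : ∀ (t : ℕ) (ρ : List ℕ) (P Q : CProc) → WF (ctr t P Q) →
    apar (apar (aloc (nm t) (enc (t ∷ ρ) P)) (aux (npb P) t ρ (enc [] Q)))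
         (apre (aout (lN t)) (apre (ain (kN t)) a0))
      ⟶* apar (enc ρ (extrD P)) (enc ρ (cpb Q))
lemma1 t ρ P Q _ with npb P in np
... | zero  = ⟶⁺⇒⟶* (⟶⁺-resp-≈ ≈-refl (Transaction.run-zero t ρ (enc (t ∷ ρ) P) (enc [] Q))
                                    (≈-trans par-comm (c-par (≈-sym (extrD-npb-zero ρ P np)) ≈-refl)))
... | suc m = ⟶⁺⇒⟶* (compensate t ρ P Q m np)
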